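{- Let $\mathcal I=(\Delta^{\mathcal I},\cdot^{\mathcal I})$ be an interpretation, $\mathcal O$ a $\mathcal{RIQ}$-ontology, $\Gamma$ a set of structural atoms, and $\lambda$ a label assignment for the labels of $\Gamma$. If $\mathcal I\models\mathcal O$, $\mathcal I,\lambda\models^\forall\Gamma$, and $[x]_\Gamma\xrightarrow{L}[y]_\Gamma$ holds in the propagation graph of $\Gamma$ with $L=L_{\mathcal O}(r)$ for a role $r$, then $(\lambda(x),\lambda(y))\in r^{\mathcal I}$.
   Context: Roles are $r$ or $r^-$ for role names $r$, with $\mathrm{Inv}(r)=r^-$, $\mathrm{Inv}(r^-)=r$, and $(r^-)^{\mathcal I}$ the converse of $r^{\mathcal I}$. A $\mathcal{RIQ}$-ontology $\mathcal O$ consists of a regular RBox (finite set of role inclusion axioms $r_1\circ\cdots\circ r_n\sqsubseteq s$, interpreted as $r_1^{\mathcal I}\circ\cdots\circ r_n^{\mathcal I}\subseteq s^{\mathcal I}$ with relational composition) and a TBox of GCIs; $\mathcal I\models\mathcal O$ means all axioms hold. $\mathbf R$-system: for each RIA $r_1\circ\cdots\circ r_n\sqsubseteq s\in\mathcal O$ there are productions $s\to r_1\cdots r_n$ and $\mathrm{Inv}(s)\to\mathrm{Inv}(r_n)\cdots\mathrm{Inv}(r_1)$; a rewrite replaces one occurrence of a role $t$ in a string of roles by $T$ for a production $t\to T$; $L_{\mathcal O}(r)$ is the set of strings reachable from the one-letter string $r$ by zero or more rewrites. Labels are drawn from a countably infinite set; structural atoms are role atoms $r(x,y)$, equality atoms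 $x\doteq y$, inequality atoms $x\not\doteq y$. A label assignment $\lambda$ maps labels to $\Delta^{\mathcal I}$; $\mathcal I,\lambda\models^\forall\Gamma$ iff $(\lambda(x),\lambda(y))\in r^{\mathcal I}$ for each $r(x,y)\in\Gamma$, $\lambda(x)=\lambda(y)$ for each $x\doteq y\in\Gamma$, and $\lambda(x)\ne\lambda(y)$ for each $x\not\doteq y\in\Gamma$. $x=^*_\Gamma y$ iff there are labels $z_1,\dots,z_m$ of $\Gamma$ ($m\ge1$), $z_1=x$, $z_m=y$, with each consecutive pair related by an equality atom of $\Gamma$ in either orientation; $[x]_\Gamma$ is the class of $x$. The propagation graph of $\Gamma$ has vertices $[x]_\Gamma$ for labels $x$ of $\Gamma$ and labelled edges $([x]_\Gamma,r,[y]_\Gamma)$ and $([y]_\Gamma,\mathrm{Inv}(r),[x]_\Gamma)$ whenever $r(z,w)\in\Gamma$ for some $z\in[x]_\Gamma$, $w\in[y]_\Gamma$. For a string $S$ of roles: $[x]_\Gamma\xrightarrow{\varepsilon}[y]_\Gamma$ iff $[x]_\Gamma=[y]_\Gamma$; $[x]_\Gamma\xrightarrow{rS}[y]_\Gamma$ iff there is an edge $([x]_\Gamma,r,[z]_\Gamma)$ with $[z]_\Gamma\xrightarrow{S}[y]_\Gamma$. For a language $L$, $[x]_\Gamma\xrightarrow{L}[y]_\Gamma$ iff $[x]_\Gamma\xrightarrow{S}[y]_\Gamma$ for some $S\in L$. -}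

module Defs where

open import Data.Nat using (ℕ; suc)
open import Data.List using (List; []; _∷_; _++_; [_]; reverse; map; length)
open import Data.List.NonEmpty using (List⁺; toList)
open import Data.List.Membership.Propositional using (_∈_)
open import Data.List.Relation.Unary.All using (All)
open import Data.List.Relation.Unary.Unique.Propositional using (Unique)
open import Data.Product using (Σ; _×_; ∃; ∃-syntax; _,_)
open import Data.Sum using (_⊎_)
open import Data.Empty using (⊥)
open import Data.Unit using (⊤)
open import Relation.Binary.PropositionalEquality using (_≡_)
open import Relation.Nullary using (¬_)

module Signature (CN RN : Set) where

  data Role : Set where
    nm  : RN → Role
    inv : RN → Role

  Inv : Role → Role
  Inv (nm r)  = inv r
  Inv (inv r) = nm r

  data Concept : Set where
    ⊤c    : Concept
    ⊥c    : Concept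
    atom  : CN → Concept
    ¬c    : Concept → Concept
    _⊓_   : Concept → Concept → Concept
    _⊔_   : Concept → Concept → Concept
    ∃r    : Role → Concept → Concept
    ∀r    : Role → Concept → Concept
    ≥r    : ℕ → Role → Concept → Concept
    ≤r    : ℕ → Role → Concept → Concept

  record RIA : Set where
    constructor _⊑ʳ_
    field
      lhs : List⁺ Role
      rhs : Role
  open RIA public

  record GCI : Set where
    constructor _⊑ᶜ_
    field
      sub sup : Concept
  open GCI public

  -- Regularity of an RBox (Horrocks–Kutz–Sattler): a strict order ≺ on
  -- roles with Inv(s) ≺ r iff s ≺ r, such that every RIA has one of the
  -- forms  r∘r ⊑ r,  r⁻ ⊑ r,  S ⊑ r,  r∘S ⊑ r,  S∘r ⊑ r  where all roles of
  -- S are ≺ r.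

  RegularForm : (Role → Role → Set) → List Role → Role → Set
  RegularForm _≺_ w r =
      (w ≡ r ∷ r ∷ [])
    ⊎ (w ≡ [ Inv r ])
    ⊎ (All (_≺ r) w)
    ⊎ (Σ (List Role) λ S → (w ≡ r ∷ S) × All (_≺ r) S)
    ⊎ (Σ (List Role) λ S → (w ≡ S ++ [ r ]) × All (_≺ r) S)

  Regular : List RIA → Set₁
  Regular R =
    Σ (Role → Role → Set) λ _≺_ →
        (∀ r → ¬ (r ≺ r))
      × (∀ r s t → r ≺ s → s ≺ t → r ≺ t)
      × (∀ s r → (Inv s ≺ r → s ≺ r) × (s ≺ r → Inv s ≺ r))
      × (∀ α → α ∈ R → RegularForm _≺_ (toList (lhs α)) (rhs α))

  -- Simple roles: s is non-simple iff some RIA with a composite left side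
  -- (n ≥ 2) has a right side t with t ⊑* s, where ⊑* is the reflexive-
  -- transitive closure of the unary RIAs closed under Inv.

  data SubRole (R : List RIA) : Role → Role → Set where
    sr-refl : ∀ {s} → SubRole R s s
    sr-step : ∀ {u t s} → (Data.List.NonEmpty.[ u ] ⊑ʳ t) ∈ R →
              SubRole R t s → SubRole R u s
    sr-inv  : ∀ {u t s} → (Data.List.NonEmpty.[ u ] ⊑ʳ t) ∈ R →
              SubRole R (Inv t) s → SubRole R (Inv u) s

  NonSimple : List RIA → Role → Set
  NonSimple R s = Σ RIA λ α → α ∈ R
    × (2 Data.Nat.≤ length (toList (lhs α)))
    × (SubRole R (rhs α) s ⊎ SubRole R (rhs α) (Inv s))

  Simple : List RIA → Role → Set
  Simple R s = ¬ NonSimple R s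

  SimpleConcept : List RIA → Concept → Set
  SimpleConcept R ⊤c = ⊤
  SimpleConcept R ⊥c = ⊤
  SimpleConcept R (atom _) = ⊤
  SimpleConcept R (¬c C) = SimpleConcept R C
  SimpleConcept R (C ⊓ D) = SimpleConcept R C × SimpleConcept R D
  SimpleConcept R (C ⊔ D) = SimpleConcept R C × SimpleConcept R D
  SimpleConcept R (∃r _ C) = SimpleConcept R C
  SimpleConcept R (∀r _ C) = SimpleConcept R C
  SimpleConcept R (≥r _ s C) = Simple R s × SimpleConcept R C
  SimpleConcept R (≤r _ s C) = Simple R s × SimpleConcept R C

  record Ontology : Set₁ where
    field
      rbox    : List RIA
      tbox    : List GCI
      regular : Regular rbox
      simple  : All (λ g → SimpleConcept rbox (sub g) × SimpleConcept rbox (sup g)) tbox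
  open Ontology public

  record Interpretation : Set₁ where
    field
      Δ   : Set
      cI  : CN → Δ → Set
      rI  : RN → Δ → Δ → Set
  open Interpretation public

  ⟦_⟧ʳ : Role → (I : Interpretation) → Δ I → Δ I → Set
  ⟦ nm r ⟧ʳ  I d e = rI I r d e
  ⟦ inv r ⟧ʳ I d e = rI I r e d

  ⟦_⟧ʷ : List Role → (I : Interpretation) → Δ I → Δ I → Set
  ⟦ [] ⟧ʷ I d e = d ≡ e
  ⟦ r ∷ w ⟧ʷ I d e = Σ (Δ I) λ f → ⟦ r ⟧ʳ I d f × ⟦ w ⟧ʷ I f e

  ⟦_⟧ᶜ : Concept → (I : Interpretation) → Δ I → Set
  ⟦ ⊤c ⟧ᶜ I d = ⊤
  ⟦ ⊥c ⟧ᶜ I d = ⊥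
  ⟦ atom A ⟧ᶜ I d = cI I A d
  ⟦ ¬c C ⟧ᶜ I d = ¬ ⟦ C ⟧ᶜ I d
  ⟦ C ⊓ D ⟧ᶜ I d = ⟦ C ⟧ᶜ I d × ⟦ D ⟧ᶜ I d
  ⟦ C ⊔ D ⟧ᶜ I d = ⟦ C ⟧ᶜ I d ⊎ ⟦ D ⟧ᶜ I d
  ⟦ ∃r r C ⟧ᶜ I d = Σ (Δ I) λ e → ⟦ r ⟧ʳ I d e × ⟦ C ⟧ᶜ I e
  ⟦ ∀r r C ⟧ᶜ I d = ∀ e → ⟦ r ⟧ʳ I d e → ⟦ C ⟧ᶜ I e
  ⟦ ≥r n r C ⟧ᶜ I d = Σ (List (Δ I)) λ es → (length es ≡ n) × Unique es
                        × All (λ e → ⟦ r ⟧ʳ I d e × ⟦ C ⟧ᶜ I e) es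
  ⟦ ≤r n r C ⟧ᶜ I d = ¬ (Σ (List (Δ I)) λ es → (length es ≡ suc n) × Unique es
                        × All (λ e → ⟦ r ⟧ʳ I d e × ⟦ C ⟧ᶜ I e) es)

  _⊨ʳ_ : Interpretation → RIA → Set
  I ⊨ʳ (w ⊑ʳ s) = ∀ d e → ⟦ toList w ⟧ʷ I d e → ⟦ s ⟧ʳ I d e

  _⊨ᶜ_ : Interpretation → GCI → Set
  I ⊨ᶜ (C ⊑ᶜ D) = ∀ d → ⟦ C ⟧ᶜ I d → ⟦ D ⟧ᶜ I d

  _⊨_ : Interpretation → Ontology → Set
  I ⊨ O = All (I ⊨ʳ_) (rbox O) × All (I ⊨ᶜ_) (tbox O)

  data Production (O : Ontology) : Role → List Role → Set where
    prod    : ∀ {w s} → (w ⊑ʳ s) ∈ rbox O → Production O s (toList w)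
    prod-inv : ∀ {w s} → (w ⊑ʳ s) ∈ rbox O →
               Production O (Inv s) (reverse (map Inv (toList w)))

  data L (O : Ontology) (r : Role) : List Role → Set where
    start   : L O r [ r ]
    rewrite′ : ∀ {u t v T} → L O r (u ++ t ∷ v) → Production O t T →
               L O r (u ++ T ++ v)

  Label : Set
  Label = ℕ

  data Atom : Set where
    roleA : Role → Label → Label → Atom
    eqA   : Label → Label → Atom
    neqA  : Label → Label → Atom

  AtomSet : Set₁
  AtomSet = Atom → Set

  LabelOf : AtomSet → Label → Set
  LabelOf Γ x = Σ Atom λ a → Γ a × Occurs a
    where
      Occurs : Atom → Set
      Occurs (roleA _ u v) = (x ≡ u) ⊎ (x ≡ v)
      Occurs (eqA u v) = (x ≡ u) ⊎ (x ≡ v)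
      Occurs (neqA u v) = (x ≡ u) ⊎ (x ≡ v)

  _,_⊨∀_ : (I : Interpretation) → (Label → Δ I) → AtomSet → Set
  I , λ' ⊨∀ Γ = ∀ a → Γ a → Sat a
    where
      Sat : Atom → Set
      Sat (roleA r x y) = ⟦ r ⟧ʳ I (λ' x) (λ' y)
      Sat (eqA x y) = λ' x ≡ λ' y
      Sat (neqA x y) = ¬ (λ' x ≡ λ' y)

  data EqStar (Γ : AtomSet) : Label → Label → Set where
    eq-refl : ∀ {x} → LabelOf Γ x → EqStar Γ x x
    eq-step : ∀ {x z y} → LabelOf Γ x → (Γ (eqA x z) ⊎ Γ (eqA z x)) →
              EqStar Γ z y → EqStar Γ x y

  -- edge ([x]_Γ, t, [y]_Γ) of the propagation graph (classes given by
  -- representatives): from r(z,w) ∈ Γ we get ([z],r,[w]) and ([w],Inv r,[z])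
  Edge : AtomSet → Label → Role → Label → Set
  Edge Γ x t y = Σ Label λ z → Σ Label λ w →
    EqStar Γ x z × EqStar Γ y w × (Γ (roleA t z w) ⊎ Γ (roleA (Inv t) w z))

  PathS : AtomSet → List Role → Label → Label → Set
  PathS Γ [] x y = EqStar Γ x y
  PathS Γ (r ∷ S) x y = Σ Label λ z → Edge Γ x r z × PathS Γ S z y

  PathL : AtomSet → (List Role → Set) → Label → Label → Set
  PathL Γ Lang x y = Σ (List Role) λ S → Lang S × PathS Γ S x y

module Submission where

open import Defs
open import Data.List using (List; []; _∷_; _++_; [_]; reverse; map)
open import Data.List.Properties using (unfold-reverse)
open import Data.List.NonEmpty using (toList)
open import Data.List.Relation.Unary.All using (lookup)
open import Data.Product using (Σ; _×_; _,_; proj₁)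
open import Data.Sum using (_⊎_; inj₁; inj₂)
open import Relation.Binary.PropositionalEquality
  using (_≡_; refl; sym; trans; subst; subst₂)

-- Every string of L_O(r) denotes a sub-relation of r in a model of O, by
-- induction on rewrites: a rewrite t → T only replaces ⟦T⟧ by the larger ⟦t⟧.
-- A path in the propagation graph of Γ denotes a chain in I through the
-- images of its vertices, since λ is constant on =*_Γ-classes and every edge
-- comes from a satisfied role atom.

module _ {CN RN : Set} where
  open Signature CN RN

  module _ (I : Interpretation) where

    ⟦Inv⟧⇒flip : ∀ t {d e} → ⟦ Inv t ⟧ʳ I d e → ⟦ t ⟧ʳ I e d
    ⟦Inv⟧⇒flip (nm _)  p = p
    ⟦Inv⟧⇒flip (inv _) p = p

    flip⇒⟦Inv⟧ : ∀ t {d e} → ⟦ t ⟧ʳ I e d → ⟦ Inv t ⟧ʳ I d e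
    flip⇒⟦Inv⟧ (nm _)  p = p
    flip⇒⟦Inv⟧ (inv _) p = p

    ⟦++⟧⁻ : ∀ u v {d e} → ⟦ u ++ v ⟧ʷ I d e →
            Σ (Δ I) λ m → ⟦ u ⟧ʷ I d m × ⟦ v ⟧ʷ I m e
    ⟦++⟧⁻ []      v p = _ , refl , p
    ⟦++⟧⁻ (_ ∷ u) v (f , q , p) with ⟦++⟧⁻ u v p
    ... | m , p₁ , p₂ = m , (f , q , p₁) , p₂

    ⟦++⟧⁺ : ∀ u v {d m e} → ⟦ u ⟧ʷ I d m → ⟦ v ⟧ʷ I m e → ⟦ u ++ v ⟧ʷ I d e
    ⟦++⟧⁺ []      v refl        q = q
    ⟦++⟧⁺ (_ ∷ u) v (f , p , ps) q = f , p , ⟦++⟧⁺ u v ps q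

    ⟦reverse-map-Inv⟧⇒flip : ∀ w {d e} → ⟦ reverse (map Inv w) ⟧ʷ I d e → ⟦ w ⟧ʷ I e d
    ⟦reverse-map-Inv⟧⇒flip []      p = sym p
    ⟦reverse-map-Inv⟧⇒flip (t ∷ w) {d} {e} p
      with ⟦++⟧⁻ (reverse (map Inv w)) [ Inv t ]
             (subst (λ S → ⟦ S ⟧ʷ I d e) (unfold-reverse (Inv t) (map Inv w)) p)
    ... | m , pw , (_ , pt , refl) = m , ⟦Inv⟧⇒flip t pt , ⟦reverse-map-Inv⟧⇒flip w pw

    module _ (O : Ontology) (I⊨O : I ⊨ O) where

      Production-sound : ∀ {t T d e} → Production O t T → ⟦ T ⟧ʷ I d e → ⟦ t ⟧ʳ I d e
      Production-sound (prod α∈O) p = lookup (proj₁ I⊨O) α∈O _ _ p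
      Production-sound (prod-inv {w} {s} α∈O) p =
        flip⇒⟦Inv⟧ s (lookup (proj₁ I⊨O) α∈O _ _ (⟦reverse-map-Inv⟧⇒flip (toList w) p))

      L-sound : ∀ {r S} → L O r S → ∀ {d e} → ⟦ S ⟧ʷ I d e → ⟦ r ⟧ʳ I d e
      L-sound start (_ , p , refl) = p
      L-sound (rewrite′ {u} {t} {v} {T} l t→T) p with ⟦++⟧⁻ u (T ++ v) p
      ... | m , pu , pTv with ⟦++⟧⁻ T v pTv
      ... | m′ , pT , pv = L-sound l (⟦++⟧⁺ u (t ∷ v) pu (m′ , Production-sound t→T pT , pv))

    module _ (Γ : AtomSet) (lab : Label → Δ I) (I,lab⊨Γ : I , lab ⊨∀ Γ) where

      EqStar-sound : ∀ {x y} → EqStar Γ x y → lab x ≡ lab y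
      EqStar-sound (eq-refl _)                = refl
      EqStar-sound (eq-step _ (inj₁ x≐z) z=*y) = trans (I,lab⊨Γ _ x≐z) (EqStar-sound z=*y)
      EqStar-sound (eq-step _ (inj₂ z≐x) z=*y) = trans (sym (I,lab⊨Γ _ z≐x)) (EqStar-sound z=*y)

      roleAtom-sound : ∀ {t z w} → Γ (roleA t z w) ⊎ Γ (roleA (Inv t) w z) →
                       ⟦ t ⟧ʳ I (lab z) (lab w)
      roleAtom-sound     (inj₁ a) = I,lab⊨Γ _ a
      roleAtom-sound {t} (inj₂ a) = ⟦Inv⟧⇒flip t (I,lab⊨Γ _ a)

      Edge-sound : ∀ {x t y} → Edge Γ x t y → ⟦ t ⟧ʳ I (lab x) (lab y)
      Edge-sound {t = t} (_ , _ , x=*z , y=*w , a) =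
        subst₂ (⟦ t ⟧ʳ I) (sym (EqStar-sound x=*z)) (sym (EqStar-sound y=*w)) (roleAtom-sound a)

      PathS-sound : ∀ S {x y} → PathS Γ S x y → ⟦ S ⟧ʷ I (lab x) (lab y)
      PathS-sound []      x=*y                = EqStar-sound x=*y
      PathS-sound (_ ∷ S) (z , edge , path) = lab z , Edge-sound edge , PathS-sound S path

lemma2 : (CN RN : Set) → let open Signature CN RN in
    (I : Interpretation) (O : Ontology) (Γ : AtomSet) (lab : Label → Δ I)
    (x y : Label) (r : Role) →
    I ⊨ O → I , lab ⊨∀ Γ → PathL Γ (L O r) x y →
    ⟦ r ⟧ʳ I (lab x) (lab y)
lemma2 CN RN I O Γ lab x y r I⊨O I,lab⊨Γ (S , S∈L , path) =
  L-sound I O I⊨O S∈L (PathS-sound I Γ lab I,lab⊨Γ S path)
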